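{- For every integer $n\ge 2$, the nim-number of $\mathsf{GEN}(\mathbb{Z}_n)$ is one larger than the nim-number of $\mathsf{DNG}(\mathbb{Z}_n)$.
   Context: For a nontrivial finite group $G$: the avoidance game $\mathsf{DNG}(G)$ has positions the subsets $P\subseteq G$ with $\langle P\rangle\neq G$, starting position $\emptyset$, and options $\operatorname{Opt}(P)=\{P\cup\{g\}:g\in G\setminus P,\ \langle P\cup\{g\}\rangle\neq G\}$. The achievement game $\mathsf{GEN}(G)$ has starting position $\emptyset$, positions $\emptyset$, the non-generating subsets, and the subsets $P$ with $\langle P\rangle=G$ such that $\langle P\setminus\{s\}\rangle\neq G$ for some $s\in P$; a non-generating $P$ has options $\{P\cup\{g\}:g\in G\setminus P\}$, a generating $P$ has no options. In both games (normal play) $\operatorname{nim}(P)=\operatorname{mex}\{\operatorname{nim}(Q):Q\in\operatorname{Opt}(P)\}$ ($\operatorname{mex}$ = least nonnegative integer not in the set), and the nim-number of the game is $\operatorname{nim}(\emptyset)$. $\mathbb{Z}_n$ is the cyclic group of order $n$. -}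

module Defs where

open import Data.Bool using (Bool; true; false; _∧_; _∨_; not; if_then_else_)
open import Data.Nat using (ℕ; zero; suc; _≡ᵇ_; _+_)
open import Data.Nat.DivMod using (_mod_)
open import Data.Fin using (Fin; toℕ)
open import Data.Fin.Subset using (Subset; ⁅_⁆; _∪_) renaming (⊥ to ∅)
open import Data.Vec using (lookup; tabulate)
open import Data.List using (List; []; _∷_; length; map; foldr)
open import Data.Bool.ListAction using (any; all)
open import Data.List.Base using (allFin)

_+ₙ_ : ∀ {n} → Fin n → Fin n → Fin n
_+ₙ_ {zero} ()
_+ₙ_ {suc k} i j = (toℕ i + toℕ j) mod (suc k)

_=ᶠ_ : ∀ {n} → Fin n → Fin n → Bool
i =ᶠ j = toℕ i ≡ᵇ toℕ j

step : ∀ {n} → Subset n → Subset n → Subset n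
step {n} P S = tabulate λ g →
  lookup S g ∨ any (λ s → any (λ p → lookup S s ∧ lookup P p ∧ ((s +ₙ p) =ᶠ g)) (allFin n)) (allFin n)

iter : ∀ {n} → ℕ → Subset n → Subset n → Subset n
iter zero    P S = S
iter (suc k) P S = iter k P (step P S)

-- The subgroup ⟨P⟩ of ℤₙ generated by P: the closure of {0} under adding
-- elements of P (in a finite group the generated submonoid is the generated
-- subgroup).  n iterations suffice since the chain of sets stabilises.
span : ∀ {n} → Subset n → Subset n
span {zero}  P = ∅
span {suc k} P = iter (suc k) P ⁅ Fin.zero ⁆

generates : ∀ {n} → Subset n → Bool
generates {n} P = all (λ g → lookup (span P) g) (allFin n)

-- mex of a finite list of naturals (the mex is at most the length).
_∈ᵇ_ : ℕ → List ℕ → Bool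
k ∈ᵇ xs = any (λ x → x ≡ᵇ k) xs

mexAux : List ℕ → ℕ → ℕ → ℕ
mexAux xs zero    k = k
mexAux xs (suc f) k = if k ∈ᵇ xs then mexAux xs f (suc k) else k

mex : List ℕ → ℕ
mex xs = mexAux xs (length xs) 0

options : ∀ {n} → (Subset n → Fin n → Bool) → Subset n → List (Subset n)
options {n} ok P =
  foldr (λ g acc → if not (lookup P g) ∧ ok P g then (P ∪ ⁅ g ⁆) ∷ acc else acc) [] (allFin n)

-- nim-number by recursion on a fuel parameter; each move adds an element, so
-- play lasts at most n moves and fuel (suc n) from ∅ never runs out.
nimF : ∀ {n} → (Subset n → Fin n → Bool) → ℕ → Subset n → ℕ
nimF ok zero    P = 0
nimF ok (suc f) P = mex (map (nimF ok f) (options ok P))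

dngOk : ∀ {n} → Subset n → Fin n → Bool
dngOk P g = not (generates (P ∪ ⁅ g ⁆))

genOk : ∀ {n} → Subset n → Fin n → Bool
genOk P g = not (generates P)

nimDNG : ℕ → ℕ
nimDNG n = nimF {n} dngOk (suc n) ∅

nimGEN : ℕ → ℕ
nimGEN n = nimF {n} genOk (suc n) ∅

module Submission where

-- From a non-generating position P, a GEN move P ∪ {g} either
-- stays non-generating, and is then also a DNG move whose GEN value is by
-- induction one more than its DNG value, or it generates ℤₙ and has GEN value 0.
-- In ℤₙ a move of the second kind always exists (add the generator 1), so the
-- GEN option values are {0} ∪ {v + 1 : v a DNG option value}, and the mex of
-- that set is one more than the DNG mex.

open import Defs
open import Data.Nat using (ℕ; suc; _≤_)
open import Relation.Binary.PropositionalEquality using (_≡_)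

open import Data.Bool using (Bool; true; false; T; not; _∧_; _∨_; if_then_else_)
open import Data.Bool.Properties using (_≟_; ¬-not; T-≡; T-∧; T-∨; not-injective; ∧-zeroʳ; ∨-identityʳ)
open import Data.Bool.ListAction using (any; all)
open import Data.Empty using (⊥)
import Data.Fin as Fin
open import Data.Fin using (Fin; toℕ; fromℕ<) renaming (zero to fzero; suc to fsuc)
open import Data.Fin.Properties using (toℕ<n; toℕ-fromℕ<; toℕ-injective; pigeonhole)
open import Data.Fin.Subset using (Subset; ⁅_⁆; _∪_; ∣_∣) renaming (⊥ to ∅; _∈_ to _∈ₛ_)
open import Data.Fin.Subset.Properties using (∣p∣≤n; ∣⊥∣≡0; p⊂q⇒∣p∣<∣q∣; p⊆p∪q; x∈p∪q⁺; x∈⁅x⁆)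
open import Data.List using (List; []; _∷_; length; map; foldr; allFin)
open import Data.List.Membership.Propositional using (_∈_; lose)
open import Data.List.Membership.Propositional.Properties using (∈-allFin)
open import Data.List.Membership.Setoid.Properties using (index-injective)
import Data.List.Relation.Unary.All as All
open import Data.List.Relation.Unary.All.Properties using (all⁻)
open import Data.List.Relation.Unary.Any as Any using (here; there)
open import Data.List.Relation.Unary.Any.Properties using (any⁺; any⁻)
open import Data.Nat using (zero; _+_; _<_; _≡ᵇ_; s≤s)
open import Data.Nat.DivMod using (m<n⇒m%n≡m)
open import Data.Nat.Properties using (n<1+n; <-irrefl; ≤-pred; m<1+n⇒m<n∨m≡n; m≤n⇒m<n∨m≡n; +-identityʳ; +-suc; +-comm; <-cmp; ≡⇒≡ᵇ; ≡ᵇ⇒≡; <-trans; ≤-reflexive; <⇒≤; <-≤-trans; +-monoˡ-≤; <⇒≱)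
open import Data.Product using (_,_; _×_; ∃₂)
open import Data.Sum using (_⊎_; inj₁; inj₂)
open import Data.Vec using (lookup)
open import Data.Vec.Properties using (lookup∘tabulate; tabulate∘lookup; tabulate-cong; lookup-replicate; []=⇒lookup)
open import Function using (Equivalence)
open import Relation.Binary.PropositionalEquality using (refl; sym; trans; cong; subst; setoid; module ≡-Reasoning)
open import Relation.Nullary using (¬_; contradiction; yes; no)
open import Relation.Binary.Definitions using (tri<; tri≈; tri>)

open Equivalence using (to; from)

∈ᵇ⇒∈ : ∀ {k} xs → T (k ∈ᵇ xs) → k ∈ xs
∈ᵇ⇒∈ {k} xs k∈xs = Any.map (λ {x} x≡k → sym (≡ᵇ⇒≡ x k x≡k)) (any⁻ _ xs k∈xs)

¬upTo-length⊆ : ∀ xs → ¬ (∀ i → i ≤ length xs → T (i ∈ᵇ xs))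
¬upTo-length⊆ xs upTo⊆ = collision (pigeonhole (n<1+n (length xs)) position)
  where
  member : (i : Fin (suc (length xs))) → toℕ i ∈ xs
  member i = ∈ᵇ⇒∈ xs (upTo⊆ (toℕ i) (≤-pred (toℕ<n i)))
  position : Fin (suc (length xs)) → Fin (length xs)
  position i = Any.index (member i)
  collision : ∃₂ (λ i j → i Fin.< j × position i ≡ position j) → ⊥
  collision (i , j , i<j , same) =
    <-irrefl (index-injective (setoid ℕ) (member i) (member j) same) i<j

mexAux-below : ∀ xs F k → (∀ i → i < k → T (i ∈ᵇ xs)) →
               ∀ i → i < mexAux xs F k → T (i ∈ᵇ xs)
mexAux-below xs zero    k below = below
mexAux-below xs (suc F) k below with k ∈ᵇ xs in k∈xs
... | false = below
... | true  = mexAux-below xs F (suc k) below′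
  where
  below′ : ∀ i → i < suc k → T (i ∈ᵇ xs)
  below′ i i<1+k with m<1+n⇒m<n∨m≡n i<1+k
  ... | inj₁ i<k  = below i i<k
  ... | inj₂ refl = from T-≡ k∈xs

mexAux-∉⊎exhausted : ∀ xs F k → ¬ T (mexAux xs F k ∈ᵇ xs) ⊎ mexAux xs F k ≡ k + F
mexAux-∉⊎exhausted xs zero    k = inj₂ (sym (+-identityʳ k))
mexAux-∉⊎exhausted xs (suc F) k with k ∈ᵇ xs in k∈xs
... | false = inj₁ (subst T k∈xs)
... | true  with mexAux-∉⊎exhausted xs F (suc k)
...   | inj₁ ∉xs       = inj₁ ∉xs
...   | inj₂ exhausted = inj₂ (trans exhausted (sym (+-suc k F)))

mex-below : ∀ xs i → i < mex xs → T (i ∈ᵇ xs)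
mex-below xs = mexAux-below xs (length xs) 0 (λ _ ())

-- If mexAux exhausts its fuel, 0, …, length xs - 1 all lie in xs; by pigeonhole
-- length xs then does not.
mex-∉ : ∀ xs → ¬ T (mex xs ∈ᵇ xs)
mex-∉ xs with mexAux-∉⊎exhausted xs (length xs) 0
... | inj₁ ∉xs      = ∉xs
... | inj₂ mex≡len = λ mex∈xs → ¬upTo-length⊆ xs (upTo⊆ mex∈xs)
  where
  upTo⊆ : T (mex xs ∈ᵇ xs) → ∀ i → i ≤ length xs → T (i ∈ᵇ xs)
  upTo⊆ mex∈xs i i≤len with m≤n⇒m<n∨m≡n i≤len
  ... | inj₁ i<len  = mex-below xs i (subst (i <_) (sym mex≡len) i<len)
  ... | inj₂ refl = subst (λ m → T (m ∈ᵇ xs)) mex≡len mex∈xs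

mex-unique : ∀ xs m → (∀ i → i < m → T (i ∈ᵇ xs)) → ¬ T (m ∈ᵇ xs) → mex xs ≡ m
mex-unique xs m below m∉xs with <-cmp (mex xs) m
... | tri< mex<m _ _ = contradiction (below (mex xs) mex<m) (mex-∉ xs)
... | tri≈ _ mex≡m _ = mex≡m
... | tri> _ _ m<mex = contradiction (mex-below xs m m<mex) m∉xs

mex-suc : ∀ xs ys → (∀ j → (suc j ∈ᵇ xs) ≡ (j ∈ᵇ ys)) → T (0 ∈ᵇ xs) →
          mex xs ≡ suc (mex ys)
mex-suc xs ys shift 0∈xs =
  mex-unique xs (suc (mex ys)) below (λ m∈xs → mex-∉ ys (subst T (shift (mex ys)) m∈xs))
  where
  below : ∀ i → i < suc (mex ys) → T (i ∈ᵇ xs)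
  below zero    _         = 0∈xs
  below (suc i) (s≤s i<m) = subst T (sym (shift i)) (mex-below ys i i<m)

toℕ-+ₙ : ∀ {n} (i j : Fin n) → toℕ i + toℕ j < n → toℕ (i +ₙ j) ≡ toℕ i + toℕ j
toℕ-+ₙ {suc n} i j i+j<n = trans (toℕ-fromℕ< _) (m<n⇒m%n≡m i+j<n)

sumset∋ : ∀ {n} → Subset n → Subset n → Fin n → Bool
sumset∋ {n} S P g = any (λ s → any (λ p → lookup S s ∧ lookup P p ∧ ((s +ₙ p) =ᶠ g)) (allFin n)) (allFin n)

lookup-step : ∀ {n} (P S : Subset n) g → lookup (step P S) g ≡ (lookup S g ∨ sumset∋ S P g)
lookup-step P S = lookup∘tabulate (λ g → lookup S g ∨ sumset∋ S P g)

step-⊇ : ∀ {n} (P S : Subset n) g → lookup S g ≡ true → lookup (step P S) g ≡ true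
step-⊇ P S g g∈S = trans (lookup-step P S g) (cong (_∨ sumset∋ S P g) g∈S)

step-+ₙ : ∀ {n} (P S : Subset n) s p → lookup S s ≡ true → lookup P p ≡ true →
          lookup (step P S) (s +ₙ p) ≡ true
step-+ₙ P S s p s∈S p∈P = trans (lookup-step P S (s +ₙ p)) (to T-≡ (from T-∨ (inj₂ s+p∈S+P)))
  where
  s+p∈S+P : T (sumset∋ S P (s +ₙ p))
  s+p∈S+P = any⁺ _ (lose (∈-allFin s) (any⁺ _ (lose (∈-allFin p)
              (from T-∧ (from T-≡ s∈S , from T-∧ (from T-≡ p∈P , ≡⇒≡ᵇ (toℕ (s +ₙ p)) _ refl))))))

_⊇≤_ : ∀ {n} → Subset n → ℕ → Set
S ⊇≤ m = ∀ i → toℕ i ≤ m → lookup S i ≡ true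

any-≡false : ∀ {A : Set} (p : A → Bool) → (∀ x → p x ≡ false) → ∀ xs → any p xs ≡ false
any-≡false p none []       = refl
any-≡false p none (x ∷ xs) = trans (cong (_∨ any p xs) (none x)) (any-≡false p none xs)

sumset∋-∅ : ∀ {n} (S : Subset n) g → sumset∋ S ∅ g ≡ false
sumset∋-∅ {n} S g = any-≡false _ (λ s → any-≡false _ (no-sum s) (allFin n)) (allFin n)
  where
  no-sum : ∀ s p → (lookup S s ∧ lookup ∅ p ∧ ((s +ₙ p) =ᶠ g)) ≡ false
  no-sum s p = trans (cong (λ b → lookup S s ∧ b ∧ ((s +ₙ p) =ᶠ g)) (lookup-replicate p false))
                     (∧-zeroʳ (lookup S s))

step-∅ : ∀ {n} (S : Subset n) → step ∅ S ≡ S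
step-∅ S = trans (tabulate-cong (λ g → trans (cong (lookup S g ∨_) (sumset∋-∅ S g)) (∨-identityʳ _)))
                 (tabulate∘lookup S)

iter-∅ : ∀ {n} j (S : Subset n) → iter j ∅ S ≡ S
iter-∅ zero    S = refl
iter-∅ (suc j) S = trans (cong (iter j ∅) (step-∅ S)) (iter-∅ j S)

module _ {k : ℕ} where

  private
    N : ℕ
    N = suc (suc k)

  one : Fin N
  one = fsuc fzero

  step-extends : ∀ (P S : Subset N) m → lookup P one ≡ true → S ⊇≤ m → step P S ⊇≤ suc m
  step-extends P S m one∈P S⊇ i i≤1+m with m≤n⇒m<n∨m≡n i≤1+m
  ... | inj₁ i<1+m = step-⊇ P S i (S⊇ i (≤-pred i<1+m))
  ... | inj₂ i≡1+m = subst (λ g → lookup (step P S) g ≡ true) m+1≡i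
                       (step-+ₙ P S s one (S⊇ s (≤-reflexive (toℕ-fromℕ< m<N))) one∈P)
    where
    m<N : m < N
    m<N = <-trans (n<1+n m) (subst (_< N) i≡1+m (toℕ<n i))
    s : Fin N
    s = fromℕ< m<N
    m+1≡i : s +ₙ one ≡ i
    m+1≡i = toℕ-injective (begin
      toℕ (s +ₙ one)  ≡⟨ toℕ-+ₙ s one (subst (_< N) (sym s+1≡i) (toℕ<n i)) ⟩
      toℕ s + 1       ≡⟨ s+1≡i ⟩
      toℕ i           ∎)
      where
      open ≡-Reasoning
      s+1≡i : toℕ s + 1 ≡ toℕ i
      s+1≡i = trans (+-comm (toℕ s) 1) (trans (cong suc (toℕ-fromℕ< m<N)) (sym i≡1+m))

  iter-extends : ∀ (P : Subset N) j (S : Subset N) m → lookup P one ≡ true →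
                 S ⊇≤ m → iter j P S ⊇≤ (m + j)
  iter-extends P zero    S m one∈P S⊇ = subst (S ⊇≤_) (sym (+-identityʳ m)) S⊇
  iter-extends P (suc j) S m one∈P S⊇ =
    subst (iter j P (step P S) ⊇≤_) (sym (+-suc m j))
      (iter-extends P j (step P S) (suc m) one∈P (step-extends P S m one∈P S⊇))

  generates-∋one : ∀ (P : Subset N) → lookup P one ≡ true → generates P ≡ true
  generates-∋one P one∈P = to T-≡ (all⁻ (lookup (span P)) (All.tabulate {xs = allFin N} λ {g} _ →
    from T-≡ (iter-extends P N ⁅ fzero ⁆ 0 one∈P zero∈⁅zero⁆ g (<⇒≤ (toℕ<n g)))))
    where
    zero∈⁅zero⁆ : ⁅ fzero ⁆ ⊇≤ 0
    zero∈⁅zero⁆ fzero _ = refl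

  generates-∅ : generates {N} ∅ ≡ false
  generates-∅ = cong (λ S → all (lookup S) (allFin N)) (iter-∅ N ⁅ fzero ⁆)

-- options ok P is movesFrom ok P (allFin n); the general list admits induction.
movesFrom : ∀ {n} → (Subset n → Fin n → Bool) → Subset n → List (Fin n) → List (Subset n)
movesFrom ok P = foldr (λ g acc → if not (lookup P g) ∧ ok P g then (P ∪ ⁅ g ⁆) ∷ acc else acc) []

movesFrom-taken : ∀ {n} (ok : Subset n → Fin n → Bool) (P : Subset n) {g} gs →
                  lookup P g ≡ true → movesFrom ok P (g ∷ gs) ≡ movesFrom ok P gs
movesFrom-taken ok P gs g∈P rewrite g∈P = refl

movesFrom-illegal : ∀ {n} (ok : Subset n → Fin n → Bool) (P : Subset n) {g} gs →
                    ok P g ≡ false → movesFrom ok P (g ∷ gs) ≡ movesFrom ok P gs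
movesFrom-illegal ok P {g} gs illegal rewrite illegal | ∧-zeroʳ (not (lookup P g)) = refl

movesFrom-legal : ∀ {n} (ok : Subset n → Fin n → Bool) (P : Subset n) {g} gs →
                  lookup P g ≡ false → ok P g ≡ true →
                  movesFrom ok P (g ∷ gs) ≡ (P ∪ ⁅ g ⁆) ∷ movesFrom ok P gs
movesFrom-legal ok P gs g∉P legal rewrite g∉P | legal = refl

movesFrom-none : ∀ {n} (ok : Subset n → Fin n → Bool) (P : Subset n) →
                 (∀ g → ok P g ≡ false) → ∀ gs → movesFrom ok P gs ≡ []
movesFrom-none ok P illegal []       = refl
movesFrom-none ok P illegal (g ∷ gs) =
  trans (movesFrom-illegal ok P gs (illegal g)) (movesFrom-none ok P illegal gs)

nimGEN-generating : ∀ {n} f (Q : Subset n) → generates Q ≡ true → nimF genOk f Q ≡ 0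
nimGEN-generating zero    Q _         = refl
nimGEN-generating (suc f) Q generating
  rewrite movesFrom-none genOk Q (λ _ → cong not generating) (allFin _) = refl

module _ {n : ℕ} {P : Subset n} (nongenerating : generates P ≡ false) (f : ℕ)
  (shifted : ∀ g → lookup P g ≡ false → dngOk P g ≡ true →
             nimF genOk f (P ∪ ⁅ g ⁆) ≡ suc (nimF dngOk f (P ∪ ⁅ g ⁆))) where

  genValues dngValues : List (Fin n) → List ℕ
  genValues gs = map (nimF genOk f) (movesFrom genOk P gs)
  dngValues gs = map (nimF dngOk f) (movesFrom dngOk P gs)

  private
    gen-legal : ∀ g → genOk P g ≡ true
    gen-legal _ = cong not nongenerating

  -- Splitting on lookup P g ≟ true instead of on lookup P g leaves the goal
  -- unnormalised, so the movesFrom equations can rewrite it.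
  genValues-shift : ∀ gs j → (suc j ∈ᵇ genValues gs) ≡ (j ∈ᵇ dngValues gs)
  genValues-shift []       j = refl
  genValues-shift (g ∷ gs) j with lookup P g ≟ true
  ... | yes g∈P rewrite movesFrom-taken genOk P gs g∈P | movesFrom-taken dngOk P gs g∈P =
    genValues-shift gs j
  ... | no g∉P with dngOk P g ≟ true
  ...   | yes legal rewrite movesFrom-legal genOk P gs (¬-not g∉P) (gen-legal g)
                          | movesFrom-legal dngOk P gs (¬-not g∉P) legal
                          | shifted g (¬-not g∉P) legal =
    cong ((nimF dngOk f (P ∪ ⁅ g ⁆) ≡ᵇ j) ∨_) (genValues-shift gs j)
  ...   | no illegal rewrite movesFrom-legal genOk P gs (¬-not g∉P) (gen-legal g)
                           | movesFrom-illegal dngOk P gs (¬-not illegal)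
                           | nimGEN-generating f (P ∪ ⁅ g ⁆) (not-injective (¬-not illegal)) =
    genValues-shift gs j

  zero∈genValues : ∀ gs g → g ∈ gs → lookup P g ≡ false → dngOk P g ≡ false →
                   T (0 ∈ᵇ genValues gs)
  zero∈genValues (g ∷ gs) g (here refl) g∉P illegal
    rewrite movesFrom-legal genOk P gs g∉P (gen-legal g)
          | nimGEN-generating f (P ∪ ⁅ g ⁆) (not-injective illegal) = _
  zero∈genValues (g′ ∷ gs) g (there g∈gs) g∉P illegal with lookup P g′ ≟ true
  ... | yes g′∈P rewrite movesFrom-taken genOk P gs g′∈P =
    zero∈genValues gs g g∈gs g∉P illegal
  ... | no g′∉P rewrite movesFrom-legal genOk P gs (¬-not g′∉P) (gen-legal g′) =
    from T-∨ (inj₂ (zero∈genValues gs g g∈gs g∉P illegal))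

∣p∣<∣p∪⁅x⁆∣ : ∀ {n} (P : Subset n) g → lookup P g ≡ false → ∣ P ∣ < ∣ P ∪ ⁅ g ⁆ ∣
∣p∣<∣p∪⁅x⁆∣ P g g∉P = p⊂q⇒∣p∣<∣q∣ (p⊆p∪q ⁅ g ⁆ , g , x∈p∪q⁺ (inj₂ (x∈⁅x⁆ g)) , g∉ₛP)
  where
  g∉ₛP : ¬ g ∈ₛ P
  g∉ₛP g∈P with () ← trans (sym ([]=⇒lookup g∈P)) g∉P

-- nimF runs on fuel; the bound n < ∣ P ∣ + f keeps it from running out along any play.
nimGEN≡suc-nimDNG : ∀ {k} f (P : Subset (2 + k)) → generates P ≡ false → 2 + k < ∣ P ∣ + f →
                    nimF genOk f P ≡ suc (nimF dngOk f P)
nimGEN≡suc-nimDNG zero P _ fuel =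
  contradiction (∣p∣≤n P) (<⇒≱ (subst (_ <_) (+-identityʳ ∣ P ∣) fuel))
nimGEN≡suc-nimDNG (suc f) P nongenerating fuel =
  mex-suc (genValues nongenerating f shifted (allFin _)) (dngValues nongenerating f shifted (allFin _))
    (genValues-shift nongenerating f shifted (allFin _))
    (zero∈genValues nongenerating f shifted (allFin _) one (∈-allFin one) one∉P adding-one-generates)
  where
  shifted : ∀ g → lookup P g ≡ false → dngOk P g ≡ true →
            nimF genOk f (P ∪ ⁅ g ⁆) ≡ suc (nimF dngOk f (P ∪ ⁅ g ⁆))
  shifted g g∉P legal =
    nimGEN≡suc-nimDNG f (P ∪ ⁅ g ⁆) (not-injective legal) (<-≤-trans fuel fuel-suffices)
    where
    fuel-suffices : ∣ P ∣ + suc f ≤ ∣ P ∪ ⁅ g ⁆ ∣ + f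
    fuel-suffices = subst (_≤ ∣ P ∪ ⁅ g ⁆ ∣ + f) (sym (+-suc ∣ P ∣ f))
                      (+-monoˡ-≤ f (∣p∣<∣p∪⁅x⁆∣ P g g∉P))
  one∉P : lookup P one ≡ false
  one∉P = ¬-not λ one∈P → contradiction (trans (sym (generates-∋one P one∈P)) nongenerating) λ ()
  adding-one-generates : dngOk P one ≡ false
  adding-one-generates =
    cong not (generates-∋one (P ∪ ⁅ one ⁆) ([]=⇒lookup (x∈p∪q⁺ {p = P} (inj₂ (x∈⁅x⁆ one)))))

proposition6p8 : (n : ℕ) → 2 ≤ n → nimGEN n ≡ suc (nimDNG n)
proposition6p8 (suc (suc k)) _ =
  nimGEN≡suc-nimDNG (3 + k) ∅ (generates-∅ {k})
    (subst (λ c → 2 + k < c + (3 + k)) (sym (∣⊥∣≡0 (2 + k))) (n<1+n (2 + k)))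
proposition6p8 (suc zero) (s≤s ())
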